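{- Let $p\ge r\ge s\ge 1$ be integers, let $\lambda=(p,r,s)$, and write $G_{(p,r,s)}(q)=\sum_{i=0}^{p+r+s}a_iq^i$. Then: (1) if $2\le p\le 2r+s$, then $a_{p-1}<a_p$; (2) if $p=1$ or $p\ge 2r+s+1$, then $a_{p-1}=a_p$ and $a_i\ge a_{i+1}$ for all $i\ge p-1$.
   Context: For an ordinary partition $\lambda=(\lambda_1,\dots,\lambda_b)$, $G_{\lambda}(q)=\sum_\mu q^{|\mu|}$ is the rank-generating function of the poset of all (not necessarily distinct-part) partitions $\mu=(\mu_1\ge\mu_2\ge\dots\ge\mu_k>0)$ whose Ferrers diagram is contained in that of $\lambda$, i.e. $k\le b$ and $\mu_i\le\lambda_i$ for all $i$ (the empty partition included); $|\mu|$ is the sum of the parts. Thus $a_i$ is the number of such partitions of $i$ with $\mu_1\le p$, $\mu_2\le r$, $\mu_3\le s$ and at most three parts. -}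

module Defs where

open import Data.Nat using (ℕ; zero; suc; _+_; _⊓_)
open import Data.List using (List; upTo; map; sum; length; filter; concatMap; [])
open import Data.List using (_∷_)
open import Data.Product using (_×_; _,_)
open import Data.Nat using (_≟_)

-- A partition μ contained in λ = (p, r, s) with at most three parts is encoded
-- as its part sequence padded with zeros: (m₁, m₂, m₃) with
-- p ≥ m₁ ≥ m₂ ≥ m₃ ≥ 0, m₂ ≤ r, m₃ ≤ s.  This is a bijection.

range : ℕ → List ℕ
range k = upTo (suc k)

subPartitions : ℕ → ℕ → ℕ → List (ℕ × ℕ × ℕ)
subPartitions p r s =
  concatMap (λ m₁ →
    concatMap (λ m₂ →
      map (λ m₃ → (m₁ , m₂ , m₃)) (range (m₂ ⊓ s)))
      (range (m₁ ⊓ r)))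
    (range p)

size : ℕ × ℕ × ℕ → ℕ
size (a , b , c) = a + b + c

-- a p r s i = coefficient of q^i in G_{(p,r,s)}(q)
--           = number of partitions μ ⊆ (p, r, s) with |μ| = i
a : ℕ → ℕ → ℕ → ℕ → ℕ
a p r s i = length (filter (λ μ → size μ ≟ i) (subPartitions p r s))

module Submission where

-- Group the diagrams μ = (μ₁, μ₂, μ₃) ⊆ (p, r, s) by their first part.  Adding a
-- box to the first row maps the diagrams of size i with μ₁ = m injectively to
-- those of size i + 1 with μ₁ = m + 1, missing exactly the ones with μ₁ = μ₂.
-- No diagram of size p − 1 has μ₁ = p, so a_{p−1} ≤ a_p, strictly as soon as
-- some (k + 1, k + 1, t) ⊆ (p, r, s) has size p, which is possible precisely
-- when 2 ≤ p ≤ 2r + s.  Conversely a diagram with μ₁ = μ₂ has size at most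
-- 2r + s, so for i ≥ 2r + s removing a box from the first row maps the diagrams
-- of size i + 1 injectively to those of size i, and a_{i+1} ≤ a_i.

open import Defs
open import Data.Bool using (true; false; if_then_else_)
open import Data.List using (List; []; _∷_; _++_; map; concatMap; filter; length; applyUpTo)
open import Data.List.Properties using (length-++; filter-++; map-cong; map-applyUpTo)
open import Data.Nat
open import Data.Nat.ListAction using (sum)
open import Data.Nat.Properties
open import Data.Product using (∃₂; _×_; _,_)
open import Data.Sum using (_⊎_; inj₁; inj₂)
open import Function using (_∘_)
open import Relation.Nullary using (Dec; does; yes; no; contradiction)
open import Relation.Nullary.Decidable using (dec-true; dec-false)
open import Relation.Unary using (Decidable)
open import Relation.Binary.PropositionalEquality

Σ≤ : ℕ → (ℕ → ℕ) → ℕ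
Σ≤ zero    f = f 0
Σ≤ (suc n) f = f 0 + Σ≤ n (f ∘ suc)

Σ≤-suc : ∀ n f → Σ≤ (suc n) f ≡ Σ≤ n f + f (suc n)
Σ≤-suc zero    f = refl
Σ≤-suc (suc n) f = trans (cong (f 0 +_) (Σ≤-suc n (f ∘ suc))) (sym (+-assoc (f 0) _ _))

Σ≤-monoˡ-≤ : ∀ f {m n} → m ≤ n → Σ≤ m f ≤ Σ≤ n f
Σ≤-monoˡ-≤ f {n = zero}  z≤n       = ≤-refl
Σ≤-monoˡ-≤ f {n = suc n} z≤n       = m≤m+n (f 0) _
Σ≤-monoˡ-≤ f             (s≤s m≤n) = +-monoʳ-≤ (f 0) (Σ≤-monoˡ-≤ (f ∘ suc) m≤n)

Σ≤-monoʳ-≤ : ∀ n {f g} → (∀ k → f k ≤ g k) → Σ≤ n f ≤ Σ≤ n g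
Σ≤-monoʳ-≤ zero    f≤g = f≤g 0
Σ≤-monoʳ-≤ (suc n) f≤g = +-mono-≤ (f≤g 0) (Σ≤-monoʳ-≤ n (f≤g ∘ suc))

Σ≤-monoʳ-< : ∀ {f g} → (∀ k → f k ≤ g k) → ∀ {k n} → k ≤ n → f k < g k → Σ≤ n f < Σ≤ n g
Σ≤-monoʳ-< f≤g {zero} {zero}  _         fk<gk = fk<gk
Σ≤-monoʳ-< f≤g {zero} {suc n} _         fk<gk = +-mono-<-≤ fk<gk (Σ≤-monoʳ-≤ n (f≤g ∘ suc))
Σ≤-monoʳ-< f≤g        (s≤s k≤n) fk<gk = +-mono-≤-< (f≤g 0) (Σ≤-monoʳ-< (f≤g ∘ suc) k≤n fk<gk)

term≤Σ≤ : ∀ f {k n} → k ≤ n → f k ≤ Σ≤ n f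
term≤Σ≤ f {zero} {zero}  _         = ≤-refl
term≤Σ≤ f {zero} {suc n} _         = m≤m+n (f 0) _
term≤Σ≤ f        (s≤s k≤n) = ≤-trans (term≤Σ≤ (f ∘ suc) k≤n) (m≤n+m _ (f 0))

Σ≤≡0 : ∀ n f → (∀ k → k ≤ n → f k ≡ 0) → Σ≤ n f ≡ 0
Σ≤≡0 zero    f f≡0 = f≡0 0 z≤n
Σ≤≡0 (suc n) f f≡0 = cong₂ _+_ (f≡0 0 z≤n) (Σ≤≡0 n (f ∘ suc) (λ k k≤n → f≡0 (suc k) (s≤s k≤n)))

sum-applyUpTo : ∀ n f → sum (applyUpTo f (suc n)) ≡ Σ≤ n f
sum-applyUpTo zero    f = +-identityʳ (f 0)
sum-applyUpTo (suc n) f = cong (f 0 +_) (sum-applyUpTo n (f ∘ suc))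

sum-range : ∀ n f → sum (map f (range n)) ≡ Σ≤ n f
sum-range n f = trans (cong sum (map-applyUpTo (λ k → k) f (suc n))) (sum-applyUpTo n f)

δ : ℕ → ℕ → ℕ
δ x j = if does (x ≟ j) then 1 else 0

δ-refl : ∀ x → δ x x ≡ 1
δ-refl x = cong (if_then 1 else 0) (dec-true (x ≟ x) refl)

δ-≢ : ∀ {x j} → x ≢ j → δ x j ≡ 0
δ-≢ {x} {j} x≢j = cong (if_then 1 else 0) (dec-false (x ≟ j) x≢j)

module _ {A : Set} {P : A → Set} (P? : Decidable P) where

  count : List A → ℕ
  count = length ∘ filter P?

  count-concatMap : ∀ {B : Set} (f : B → List A) xs → count (concatMap f xs) ≡ sum (map (count ∘ f) xs)
  count-concatMap f []       = refl
  count-concatMap f (x ∷ xs) = begin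
    count (f x ++ concatMap f xs)                            ≡⟨ cong length (filter-++ P? (f x) (concatMap f xs)) ⟩
    length (filter P? (f x) ++ filter P? (concatMap f xs))   ≡⟨ length-++ (filter P? (f x)) ⟩
    count (f x) + count (concatMap f xs)                     ≡⟨ cong (count (f x) +_) (count-concatMap f xs) ⟩
    count (f x) + sum (map (count ∘ f) xs)                   ∎
    where open ≡-Reasoning

  count-map : ∀ {B : Set} (g : B → A) xs →
              count (map g xs) ≡ sum (map (λ x → if does (P? (g x)) then 1 else 0) xs)
  count-map g []       = refl
  count-map g (x ∷ xs) with does (P? (g x))
  ... | true  = cong suc (count-map g xs)
  ... | false = count-map g xs

  count-concatMap-range : ∀ n (f : ℕ → List A) {h : ℕ → ℕ} → (∀ k → count (f k) ≡ h k) →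
                          count (concatMap f (range n)) ≡ Σ≤ n h
  count-concatMap-range n f {h} count-f = begin
    count (concatMap f (range n))   ≡⟨ count-concatMap f (range n) ⟩
    sum (map (count ∘ f) (range n)) ≡⟨ cong sum (map-cong count-f (range n)) ⟩
    sum (map h (range n))           ≡⟨ sum-range n h ⟩
    Σ≤ n h                          ∎
    where open ≡-Reasoning

  count-map-range : ∀ n (g : ℕ → A) →
                    count (map g (range n)) ≡ Σ≤ n (λ k → if does (P? (g k)) then 1 else 0)
  count-map-range n g = trans (count-map g (range n)) (sum-range n _)

module Slices (r s : ℕ) where

  completions : ℕ → ℕ → ℕ → ℕ
  completions μ₁ j μ₂ = Σ≤ (μ₂ ⊓ s) (λ μ₃ → δ (μ₁ + μ₂ + μ₃) j)

  slice : ℕ → ℕ → ℕ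
  slice μ₁ j = Σ≤ (μ₁ ⊓ r) (completions μ₁ j)

  a≡Σ≤slice : ∀ p i → a p r s i ≡ Σ≤ p (λ μ₁ → slice μ₁ i)
  a≡Σ≤slice p i =
    count-concatMap-range size≟i p with-first λ μ₁ →
    count-concatMap-range size≟i (μ₁ ⊓ r) (with-first-two μ₁) λ μ₂ →
    count-map-range size≟i (μ₂ ⊓ s) (λ μ₃ → μ₁ , μ₂ , μ₃)
    where
      size≟i : (μ : ℕ × ℕ × ℕ) → Dec (size μ ≡ i)
      size≟i μ = size μ ≟ i
      with-first-two : ℕ → ℕ → List (ℕ × ℕ × ℕ)
      with-first-two μ₁ μ₂ = map (λ μ₃ → μ₁ , μ₂ , μ₃) (range (μ₂ ⊓ s))
      with-first : ℕ → List (ℕ × ℕ × ℕ)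
      with-first μ₁ = concatMap (with-first-two μ₁) (range (μ₁ ⊓ r))

  slice-below : ∀ {μ₁ j} → j < μ₁ → slice μ₁ j ≡ 0
  slice-below {μ₁} {j} j<μ₁ =
    Σ≤≡0 (μ₁ ⊓ r) _ λ μ₂ _ → Σ≤≡0 (μ₂ ⊓ s) _ λ μ₃ _ →
    δ-≢ (>⇒≢ (<-≤-trans j<μ₁ (≤-trans (m≤m+n μ₁ μ₂) (m≤m+n (μ₁ + μ₂) μ₃))))

  -- Definitionally completions (suc m) (suc j) = completions m j: adding a box
  -- to the first row only enlarges the range of μ₂.
  slice≤slice-suc : ∀ m j → slice m j ≤ slice (suc m) (suc j)
  slice≤slice-suc m j = Σ≤-monoˡ-≤ (completions m j) (⊓-monoˡ-≤ r (n≤1+n m))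

  slice-suc : ∀ {m} j → m < r → slice (suc m) (suc j) ≡ slice m j + completions m j (suc m)
  slice-suc {m} j m<r = begin
    Σ≤ (suc m ⊓ r) (completions m j)             ≡⟨ cong (λ n → Σ≤ n (completions m j)) (m≤n⇒m⊓n≡m m<r) ⟩
    Σ≤ (suc m) (completions m j)                 ≡⟨ Σ≤-suc m (completions m j) ⟩
    Σ≤ m (completions m j) + completions m j (suc m)
      ≡⟨ cong (λ n → Σ≤ n (completions m j) + completions m j (suc m)) (sym (m≤n⇒m⊓n≡m (<⇒≤ m<r))) ⟩
    slice m j + completions m j (suc m)          ∎
    where open ≡-Reasoning

  slice-suc-≥ : ∀ {m} j → r ≤ m → slice (suc m) (suc j) ≡ slice m j
  slice-suc-≥ {m} j r≤m = cong (λ n → Σ≤ n (completions m j))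
    (trans (m≥n⇒m⊓n≡n (m≤n⇒m≤1+n r≤m)) (sym (m≥n⇒m⊓n≡n r≤m)))

  slice<slice-suc : ∀ {m j t} → m < r → t ≤ s → t ≤ suc m → m + suc m + t ≡ j →
                    slice m j < slice (suc m) (suc j)
  slice<slice-suc {m} {j} {t} m<r t≤s t≤m+1 size≡j = begin-strict
    slice m j                            <⟨ m<m+n (slice m j) equal-rows ⟩
    slice m j + completions m j (suc m)  ≡⟨ slice-suc j m<r ⟨
    slice (suc m) (suc j)                ∎
    where
      open ≤-Reasoning
      equal-rows : 1 ≤ completions m j (suc m)
      equal-rows = subst (_≤ completions m j (suc m))
        (trans (cong (λ x → δ x j) size≡j) (δ-refl j))
        (term≤Σ≤ (λ μ₃ → δ (m + suc m + μ₃) j) (⊓-glb t≤m+1 t≤s))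

  slice-suc-large : ∀ m {j} → 2 * r + s ≤ j → slice (suc m) (suc j) ≡ slice m j
  slice-suc-large m {j} 2r+s≤j with m <? r
  ... | no  m≮r = slice-suc-≥ j (≮⇒≥ m≮r)
  ... | yes m<r = begin
    slice (suc m) (suc j)                 ≡⟨ slice-suc j m<r ⟩
    slice m j + completions m j (suc m)   ≡⟨ cong (slice m j +_) no-equal-rows ⟩
    slice m j + 0                         ≡⟨ +-identityʳ (slice m j) ⟩
    slice m j                             ∎
    where
      open ≡-Reasoning
      too-small : ∀ {μ₃} → μ₃ ≤ s → m + suc m + μ₃ < j
      too-small {μ₃} μ₃≤s = ≤.begin-strict
        m + suc m + μ₃ ≤.<⟨ +-mono-<-≤ (+-mono-<-≤ m<r m<r) μ₃≤s ⟩
        r + r + s      ≤.≡⟨ cong (λ x → r + x + s) (+-identityʳ r) ⟨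
        2 * r + s      ≤.≤⟨ 2r+s≤j ⟩
        j              ≤.∎
        where module ≤ = ≤-Reasoning
      no-equal-rows : completions m j (suc m) ≡ 0
      no-equal-rows = Σ≤≡0 (suc m ⊓ s) _ λ μ₃ μ₃≤ →
        δ-≢ (<⇒≢ (too-small (≤-trans μ₃≤ (m⊓n≤n (suc m) s))))

  -- The leading slice 0 (suc i) vanishes definitionally.
  a-suc-shift : ∀ q i → a (suc q) r s (suc i) ≡ Σ≤ q (λ m → slice (suc m) (suc i))
  a-suc-shift q i = a≡Σ≤slice (suc q) (suc i)

  a-suc-last : ∀ q i → a (suc q) r s i ≡ Σ≤ q (λ m → slice m i) + slice (suc q) i
  a-suc-last q i = trans (a≡Σ≤slice (suc q) i) (Σ≤-suc q (λ m → slice m i))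

  a-pred : ∀ q → a (suc q) r s q ≡ Σ≤ q (λ m → slice m q)
  a-pred q = begin
    a (suc q) r s q                          ≡⟨ a-suc-last q q ⟩
    Σ≤ q (λ m → slice m q) + slice (suc q) q ≡⟨ cong (Σ≤ q (λ m → slice m q) +_) (slice-below (n<1+n q)) ⟩
    Σ≤ q (λ m → slice m q) + 0               ≡⟨ +-identityʳ _ ⟩
    Σ≤ q (λ m → slice m q)                   ∎
    where open ≡-Reasoning

  a-pred≤a : ∀ q → a (suc q) r s q ≤ a (suc q) r s (suc q)
  a-pred≤a q = begin
    a (suc q) r s q                        ≡⟨ a-pred q ⟩
    Σ≤ q (λ m → slice m q)                 ≤⟨ Σ≤-monoʳ-≤ q (λ m → slice≤slice-suc m q) ⟩
    Σ≤ q (λ m → slice (suc m) (suc q))     ≡⟨ a-suc-shift q q ⟨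
    a (suc q) r s (suc q)                  ∎
    where open ≤-Reasoning

  a-pred<a : ∀ {q k t} → k < r → t ≤ s → t ≤ suc k → k + suc k + t ≡ q →
             a (suc q) r s q < a (suc q) r s (suc q)
  a-pred<a {q} {k} {t} k<r t≤s t≤k+1 size≡q = begin-strict
    a (suc q) r s q                        ≡⟨ a-pred q ⟩
    Σ≤ q (λ m → slice m q)
      <⟨ Σ≤-monoʳ-< (λ m → slice≤slice-suc m q) k≤q (slice<slice-suc k<r t≤s t≤k+1 size≡q) ⟩
    Σ≤ q (λ m → slice (suc m) (suc q))     ≡⟨ a-suc-shift q q ⟨
    a (suc q) r s (suc q)                  ∎
    where
      open ≤-Reasoning
      k≤q : k ≤ q
      k≤q = ≤-trans (≤-trans (m≤m+n k (suc k)) (m≤m+n (k + suc k) t)) (≤-reflexive size≡q)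

  a-suc≤a : ∀ q {i} → 2 * r + s ≤ i → a (suc q) r s (suc i) ≤ a (suc q) r s i
  a-suc≤a q {i} 2r+s≤i = begin
    a (suc q) r s (suc i)                   ≡⟨ a-suc-shift q i ⟩
    Σ≤ q (λ m → slice (suc m) (suc i))      ≤⟨ Σ≤-monoʳ-≤ q (λ m → ≤-reflexive (slice-suc-large m 2r+s≤i)) ⟩
    Σ≤ q (λ m → slice m i)                  ≤⟨ m≤m+n _ (slice (suc q) i) ⟩
    Σ≤ q (λ m → slice m i) + slice (suc q) i ≡⟨ a-suc-last q i ⟨
    a (suc q) r s i                         ∎
    where open ≤-Reasoning

  a-antitone-from : ∀ q {i} → 2 * r + s ≤ i → a (suc q) r s (i + 1) ≤ a (suc q) r s i
  a-antitone-from q {i} 2r+s≤i =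
    subst (λ j → a (suc q) r s j ≤ a (suc q) r s i) (+-comm 1 i) (a-suc≤a q 2r+s≤i)

open Slices

odd+bit : ∀ q → 1 ≤ q → ∃₂ λ k t → t ≤ 1 × k + suc k + t ≡ q
odd+bit 1                   _ = 0 , 0 , z≤n , refl
odd+bit 2                   _ = 0 , 1 , ≤-refl , refl
odd+bit (suc (suc (suc q))) _ with odd+bit (suc q) (s≤s z≤n)
... | k , t , t≤1 , eq = suc k , t , t≤1 , cong suc (trans (cong (_+ t) (+-suc k (suc k))) (cong suc eq))

-- A diagram (k + 1, k + 1, t) ⊆ (·, r, s) of size q + 1.
equal-rows-witness : ∀ {q r s} → 1 ≤ q → q < 2 * r + s → s ≤ r → 1 ≤ s →
                     ∃₂ λ k t → k < r × t ≤ s × t ≤ suc k × k + suc k + t ≡ q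
equal-rows-witness {r = zero} _ _ s≤0 1≤s = contradiction (≤-trans 1≤s s≤0) λ ()
equal-rows-witness {q} {suc k} {s} 1≤q q<2r+s s≤r 1≤s with suc k + suc k ≤? suc q
... | yes (s≤s 2k+1≤q) = k , q ∸ (k + suc k) , ≤-refl , t≤s , ≤-trans t≤s s≤r , m+[n∸m]≡n 2k+1≤q
  where
    q≤2k+1+s : q ≤ k + suc k + s
    q≤2k+1+s = s≤s⁻¹ (subst (λ x → suc q ≤ suc k + x + s) (+-identityʳ (suc k)) q<2r+s)
    t≤s : q ∸ (k + suc k) ≤ s
    t≤s = m≤n+o⇒m∸n≤o q (k + suc k) q≤2k+1+s
... | no 2r≰q+1 with odd+bit q 1≤q
...   | k′ , t , t≤1 , eq = k′ , t , k′<r , ≤-trans t≤1 1≤s , ≤-trans t≤1 (s≤s z≤n) , eq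
  where
    k′<r : k′ < suc k
    k′<r = ≰⇒> λ r≤k′ → 2r≰q+1 (begin
      suc k + suc k   ≤⟨ +-mono-≤ r≤k′ (m≤n⇒m≤1+n r≤k′) ⟩
      k′ + suc k′     ≤⟨ m≤m+n _ t ⟩
      k′ + suc k′ + t ≡⟨ eq ⟩
      q               ≤⟨ n≤1+n q ⟩
      suc q           ∎)
      where open ≤-Reasoning

coefficient-rises : ∀ {p r s} → r ≥ s → s ≥ 1 → 2 ≤ p → p ≤ 2 * r + s → a p r s (p ∸ 1) < a p r s p
coefficient-rises {suc q} r≥s s≥1 (s≤s 1≤q) q<2r+s with equal-rows-witness 1≤q q<2r+s r≥s s≥1
... | k , t , k<r , t≤s , t≤k+1 , eq = a-pred<a _ _ k<r t≤s t≤k+1 eq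

-- Here 2r + s = 3, so only i ≥ 3 is covered by a-antitone-from; G = 1 + q + q² + q³.
a₁₁₁-antitone : ∀ i → a 1 1 1 (i + 1) ≤ a 1 1 1 i
a₁₁₁-antitone 0                   = ≤-refl
a₁₁₁-antitone 1                   = ≤-refl
a₁₁₁-antitone 2                   = ≤-refl
a₁₁₁-antitone (suc (suc (suc i))) = a-antitone-from 1 1 0 {3 + i} (s≤s (s≤s (s≤s z≤n)))

coefficient-plateau : ∀ {p r s} → p ≥ r → r ≥ s → s ≥ 1 → (p ≡ 1 ⊎ p ≥ 2 * r + s + 1) →
  (a p r s (p ∸ 1) ≡ a p r s p) × ((i : ℕ) → i ≥ p ∸ 1 → a p r s i ≥ a p r s (i + 1))
coefficient-plateau {1} p≥r r≥s s≥1 (inj₁ refl)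
  with refl ← ≤-antisym p≥r (≤-trans s≥1 r≥s) | refl ← ≤-antisym (≤-trans r≥s p≥r) s≥1 =
  refl , λ i _ → a₁₁₁-antitone i
coefficient-plateau {zero}  _ _ _ (inj₂ p>2r+s) = contradiction (≤-trans (m≤n+m 1 _) p>2r+s) λ ()
coefficient-plateau {suc q} {r} {s} _ _ _ (inj₂ p>2r+s) =
  ≤-antisym (a-pred≤a r s q) (a-suc≤a r s q 2r+s≤q) , λ i q≤i → a-antitone-from r s q (≤-trans 2r+s≤q q≤i)
  where
    2r+s≤q : 2 * r + s ≤ q
    2r+s≤q = s≤s⁻¹ (subst (_≤ suc q) (+-comm (2 * r + s) 1) p>2r+s)

lemma3p5 : (p r s : ℕ) → p ≥ r → r ≥ s → s ≥ 1 →
    ((2 ≤ p → p ≤ 2 * r + s → a p r s (p ∸ 1) < a p r s p)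
    × ((p ≡ 1 ⊎ p ≥ 2 * r + s + 1) →
        (a p r s (p ∸ 1) ≡ a p r s p)
        × ((i : ℕ) → i ≥ p ∸ 1 → a p r s i ≥ a p r s (i + 1))))
lemma3p5 p r s p≥r r≥s s≥1 = coefficient-rises r≥s s≥1 , coefficient-plateau p≥r r≥s s≥1
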